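{- For $1\le k\le n-1$, \[e_k(\mathbf u)=\sum_{A\subseteq\{0,\dots,n-1\},\ |A|=k}\tilde u_A,\] where for a $k$-subset $A$, $\tilde u_A$ denotes any product $u_{a_1}u_{a_2}\cdots u_{a_k}$ of the generators $u_a$, $a\in A$, each once, such that whenever $i$ and $i+1$ (mod $n$) both lie in $A$, $u_i$ precedes $u_{i+1}$.
   Context: Fix $n\ge3$; indices mod $n$. $\mathcal U_n$ is the $\mathbb C$-algebra generated by $u_0,\dots,u_{n-1}$ with $u_i^2=0$, $u_iu_{i+1}u_i=u_{i+1}u_iu_{i+1}$, $u_iu_j=u_ju_i$ for $|i-j|\ge2$. For $A\subsetneq\{0,\dots,n-1\}$, $u_A$ is the product of the $u_a$, $a\in A$, in any order where $u_{i+1}$ precedes $u_i$ whenever $i,i+1\in A$; $h_k(\mathbf u)=\sum_{|A|=k}u_A$ for $0\le k\le n-1$. The algebra $\Lambda_{(n)}=\mathbb C[h_1,\dots,h_{n-1}]$ (complete homogeneous symmetric functions) maps isomorphically onto the subalgebra of $\mathcal U_n$ generated by $h_1(\mathbf u),\dots,h_{n-1}(\mathbf u)$ via $h_i\mapsto h_i(\mathbf u)$; for $f\in\Lambda_{(n)}$, $f(\mathbf u)$ denotes its image. In particular $e_k(\mathbf u)$ is the image of the elementary symmetric function $e_k$ ($1\le k\le n-1$). -}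

module Defs where


open import Algebra.Bundles using (Ring)
open import Data.Nat using (ℕ; zero; suc; _%_; _∸_; _<_)
open import Data.Nat.DivMod using (m%n<n)
open import Data.Fin using (Fin; toℕ; fromℕ<)
open import Data.Fin.Subset using (Subset; ∣_∣; _∈_; inside; outside)
open import Data.Vec using ([]; _∷_)
open import Data.List using (List; []; _∷_; _++_; map; foldr; zipWith; upTo)
import Data.List.Membership.Propositional as LM
open import Data.List.Relation.Unary.Unique.Propositional using (Unique)
open import Data.Product using (_×_; ∃-syntax)
open import Relation.Binary.PropositionalEquality using (_≡_)
open import Relation.Nullary using (¬_)
open import Relation.Nullary.Decidable using (does)
open import Data.Nat.Properties using (_≟_)
open import Data.Bool using (if_then_else_)

next : ∀ {n} → Fin n → Fin n
next {zero} ()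
next {suc m} i = fromℕ< (m%n<n (suc (toℕ i)) (suc m))

allSubsets : (n : ℕ) → List (Subset n)
allSubsets zero = [] ∷ []
allSubsets (suc n) =
  map (inside ∷_) (allSubsets n) ++ map (outside ∷_) (allSubsets n)

Precedes : ∀ {A : Set} → A → A → List A → Set
Precedes x y l = ∃[ l₁ ] ∃[ l₂ ] ∃[ l₃ ] (l ≡ l₁ ++ (x ∷ l₂ ++ (y ∷ l₃)))

Enumerates : ∀ {n} → Subset n → List (Fin n) → Set
Enumerates {n} A l =
  Unique l × ((a : Fin n) → (a ∈ A → a LM.∈ l) × (a LM.∈ l → a ∈ A))

HOrder : ∀ {n} → Subset n → List (Fin n) → Set
HOrder {n} A l =
  Enumerates A l × ((i : Fin n) → i ∈ A → next i ∈ A → Precedes (next i) i l)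

EOrder : ∀ {n} → Subset n → List (Fin n) → Set
EOrder {n} A l =
  Enumerates A l × ((i : Fin n) → i ∈ A → next i ∈ A → Precedes i (next i) l)

module _ {c ℓ} (R : Ring c ℓ) where
  open Ring R

  Relations : (n : ℕ) → (Fin n → Carrier) → Set ℓ
  Relations n u =
    ((i : Fin n) → u i * u i ≈ 0#) ×
    ((i : Fin n) → u i * u (next i) * u i ≈ u (next i) * u i * u (next i)) ×
    ((i j : Fin n) → ¬ (i ≡ j) → ¬ (j ≡ next i) → ¬ (i ≡ next j) →
       u i * u j ≈ u j * u i)

  sumR : List Carrier → Carrier
  sumR = foldr _+_ 0#

  prodU : ∀ {n} → (Fin n → Carrier) → List (Fin n) → Carrier
  prodU u l = foldr (λ a r → u a * r) 1# l

  sumSubsets : (n k : ℕ) → (Subset n → Carrier) → Carrier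
  sumSubsets n k f =
    sumR (map (λ A → if does (∣ A ∣ ≟ k) then f A else 0#) (allSubsets n))

  hU : (n : ℕ) → (Fin n → Carrier) → (Subset n → List (Fin n)) → ℕ → Carrier
  hU n u σ k = sumSubsets n k (λ A → prodU u (σ A))

  sgn : ℕ → Carrier
  sgn zero = 1#
  sgn (suc i) = - sgn i

  -- eList m = [e_m(u), e_{m-1}(u), …, e_0(u)], via Newton's identity
  --   e_m = Σ_{i=1}^{m} (-1)^{i-1} h_i e_{m-i}
  eList : (n : ℕ) → (Fin n → Carrier) → (Subset n → List (Fin n)) → ℕ → List Carrier
  eList n u σ zero = 1# ∷ []
  eList n u σ (suc m) =
    sumR (zipWith (λ i e → sgn i * (hU n u σ (suc i) * e)) (upTo (suc m)) (eList n u σ m))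
    ∷ eList n u σ m

  head0 : List Carrier → Carrier
  head0 [] = 0#
  head0 (x ∷ _) = x

  eU : (n : ℕ) → (Fin n → Carrier) → (Subset n → List (Fin n)) → ℕ → Carrier
  eU n u σ k = head0 (eList n u σ k)

{-# OPTIONS --safe #-}
module Submission where

-- Write u_B for the product over an h-ordering of B and ũ_A for the product over an
-- e-ordering of A; any two admissible orderings give the same product because
-- generators with non-adjacent indices commute. Since e_k(u) is defined from the h_k(u)
-- by Newton's recursion, it suffices that Q_k = Σ_{|A|=k} ũ_A satisfies
-- Σ_{j ≤ N} (-1)^j h_j(u) Q_{N-j} = 0 for 0 < N < n, i.e. that
-- Σ_{|A|+|B|=N} (-1)^{|B|} u_B ũ_A = 0. For such a pair, A ∪ B is neither empty nor
-- everything, so it has a boundary point p ∉ A ∪ B with i = p+1 ∈ A ∪ B, chosen as a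
-- function of A ∪ B alone. As p ∉ B, u_i can be moved to the end of u_B, and as p ∉ A,
-- to the front of ũ_A. If i lies in both A and B the term contains u_i² = 0; otherwise
-- moving i from A to B (or back) keeps A ∪ B and |A| + |B|, flips the sign and keeps
-- u_B ũ_A, so the terms cancel in pairs.

open import Defs
open import Algebra.Bundles using (Ring)
open import Data.Bool using (Bool; true; false; not; _∨_; _∧_; if_then_else_)
open import Data.Bool.Properties using (not-involutive)
open import Data.Empty using (⊥-elim)
open import Data.Fin using (Fin; zero; suc; toℕ; fromℕ; inject₁; _≟_)
open import Data.Fin.Induction using (<-weakInduction; <-weakInduction-startingFrom)
open import Data.Fin.Properties
  using (toℕ-injective; toℕ-fromℕ<; toℕ-fromℕ; toℕ-inject₁; toℕ<n; ≤fromℕ; suc-injective; any?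
        ; ¬∀⟶∃¬)
open import Data.Fin.Relation.Unary.Top using (view; ‵fromℕ; ‵inject₁)
open import Data.Fin.Subset using (Subset; _∈_; _∉_; _∪_; ∣_∣; ⊤; ⊥; Nonempty; inside; outside)
open import Data.Fin.Subset.Properties
  using ( _∈?_; nonempty?; Empty-unique; ∣⊥∣≡0; ∣⊤∣≡n; ∈⊤; ⊆⊤; ∉⊥; p⊂q⇒∣p∣<∣q∣
        ; p⊆q⇒∣p∣≤∣q∣; p⊆p∪q; q⊆p∪q; x∈p∪q⁻)
open import Data.List using (List; []; _∷_; _++_; [_]; map; upTo; applyUpTo; zipWith; allFin)
open import Data.List.Properties using (map-upTo)
open import Data.List.Membership.Propositional using () renaming (_∈_ to _∈ₗ_; _∉_ to _∉ₗ_)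
open import Data.List.Membership.Propositional.Properties
  using (∈-++⁺ˡ; ∈-++⁺ʳ; ∈-++⁻; ∈-∃++; ∈-upTo⁺; ∈-upTo⁻; ∈-allFin)
open import Data.List.Relation.Binary.Pointwise using (Pointwise; []; _∷_; head)
open import Data.List.Relation.Binary.Subset.Propositional using () renaming (_⊆_ to _⊆ₗ_)
open import Data.List.Relation.Unary.All as All using ([]; _∷_)
open import Data.List.Relation.Unary.AllPairs using ([]; _∷_)
open import Data.List.Relation.Unary.Any using (here; there)
open import Data.List.Relation.Unary.Unique.Propositional using (Unique)
open import Data.List.Relation.Unary.Unique.Propositional.Properties
  using (Unique[x∷xs]⇒x∉xs; ++⁺; upTo⁺; allFin⁺)
open import Data.Maybe using (Maybe; just; nothing)
import Data.Maybe.Properties as Maybe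
open import Data.Nat as ℕ using (ℕ; _∸_; _%_; _≤_; _<_; s≤s; z≤n)
import Data.Nat.Properties as ℕ
open import Data.Nat.DivMod using (m<n⇒m%n≡m; n%n≡0)
open import Data.Product using (∃; _×_; _,_; proj₁; proj₂)
open import Data.Sum as Sum using (_⊎_; inj₁; inj₂)
open import Data.Vec using ([]; _∷_; lookup; updateAt; here; there)
open import Data.Vec.Properties
  using ( lookup∘updateAt; lookup∘updateAt′; updateAt-updateAt-local; updateAt-id
        ; []=⇒lookup; lookup⇒[]=)
open import Function using (_∘_)
open import Level using (Level)
open import Relation.Binary.Definitions using (DecidableEquality)
open import Relation.Binary.PropositionalEquality as ≡ using (_≡_; _≢_; refl; module ≡-Reasoning)
open import Relation.Nullary using (¬_; Dec; does; yes; no; contradiction; ¬?; _×-dec_)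
open import Relation.Unary using (Pred; Decidable)

private variable
  m n : ℕ

next-fromℕ : ∀ m → next (fromℕ m) ≡ zero
next-fromℕ m = toℕ-injective (begin
  toℕ (next (fromℕ m))            ≡⟨ toℕ-fromℕ< _ ⟩
  ℕ.suc (toℕ (fromℕ m)) % ℕ.suc m ≡⟨ ≡.cong (λ k → ℕ.suc k % ℕ.suc m) (toℕ-fromℕ m) ⟩
  ℕ.suc m % ℕ.suc m               ≡⟨ n%n≡0 (ℕ.suc m) ⟩
  0                               ∎)
  where open ≡-Reasoning

next-inject₁ : (j : Fin m) → next (inject₁ j) ≡ suc j
next-inject₁ {m} j = toℕ-injective (begin
  toℕ (next (inject₁ j))            ≡⟨ toℕ-fromℕ< _ ⟩
  ℕ.suc (toℕ (inject₁ j)) % ℕ.suc m ≡⟨ ≡.cong (λ k → ℕ.suc k % ℕ.suc m) (toℕ-inject₁ j) ⟩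
  ℕ.suc (toℕ j) % ℕ.suc m           ≡⟨ m<n⇒m%n≡m (s≤s (toℕ<n j)) ⟩
  ℕ.suc (toℕ j)                     ∎)
  where open ≡-Reasoning

next-injective : {i j : Fin n} → next i ≡ next j → i ≡ j
next-injective {ℕ.suc m} {i} {j} eq with view i | view j
... | ‵fromℕ     | ‵fromℕ     = refl
... | ‵fromℕ     | ‵inject₁ b
  with () ← ≡.trans (≡.sym (next-fromℕ m)) (≡.trans eq (next-inject₁ b))
... | ‵inject₁ a | ‵fromℕ
  with () ← ≡.trans (≡.sym (next-fromℕ m)) (≡.trans (≡.sym eq) (next-inject₁ a))
... | ‵inject₁ a | ‵inject₁ b =
  ≡.cong inject₁ (suc-injective (≡.trans (≡.sym (next-inject₁ a)) (≡.trans eq (next-inject₁ b))))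

next-irreflexive : 2 ≤ n → (i : Fin n) → next i ≢ i
next-irreflexive {ℕ.suc (ℕ.suc m)} (s≤s (s≤s z≤n)) i eq with view i
... | ‵fromℕ     with () ← ≡.trans (≡.sym (next-fromℕ (ℕ.suc m))) eq
... | ‵inject₁ j = ℕ.1+n≢n (begin
  ℕ.suc (toℕ j)          ≡⟨ ≡.cong toℕ (next-inject₁ j) ⟨
  toℕ (next (inject₁ j)) ≡⟨ ≡.cong toℕ eq ⟩
  toℕ (inject₁ j)        ≡⟨ toℕ-inject₁ j ⟩
  toℕ j                  ∎)
  where open ≡-Reasoning

next-closed⇒universal : ∀ {ℓ} (Q : Pred (Fin (ℕ.suc m)) ℓ) → (∀ i → Q i → Q (next i)) →
                        ∀ {y} → Q y → ∀ x → Q x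
next-closed⇒universal {m} Q closed {y} Qy = <-weakInduction Q Q-zero step
  where
  step : ∀ j → Q (inject₁ j) → Q (suc j)
  step j = ≡.subst Q (next-inject₁ j) ∘ closed (inject₁ j)
  Q-zero : Q zero
  Q-zero = ≡.subst Q (next-fromℕ m) (closed _ (<-weakInduction-startingFrom Q Qy step (≤fromℕ y)))

toggle : Fin n → Subset n → Subset n
toggle i S = updateAt S i not

toggle-involutive : (i : Fin n) (S : Subset n) → toggle i (toggle i S) ≡ S
toggle-involutive i S = ≡.trans (updateAt-updateAt-local i S (not-involutive _)) (updateAt-id i S)

lookup-toggle : (i : Fin n) (S : Subset n) → lookup (toggle i S) i ≡ not (lookup S i)
lookup-toggle i S = lookup∘updateAt i S

lookup≡false⇒∉ : {i : Fin n} {S : Subset n} → lookup S i ≡ false → i ∉ S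
lookup≡false⇒∉ eq i∈S with () ← ≡.trans (≡.sym ([]=⇒lookup i∈S)) eq

∉-toggle : {i : Fin n} {S : Subset n} → i ∈ S → i ∉ toggle i S
∉-toggle {i = i} {S} i∈S = lookup≡false⇒∉ (≡.trans (lookup-toggle i S) (≡.cong not ([]=⇒lookup i∈S)))

∈-toggle : {i : Fin n} {S : Subset n} → i ∉ S → i ∈ toggle i S
∈-toggle {i = i} {S} i∉S with lookup S i in eq
... | true  = contradiction (lookup⇒[]= i S eq) i∉S
... | false = lookup⇒[]= i _ (≡.trans (lookup-toggle i S) (≡.cong not eq))

∈-toggle⁺ : {i j : Fin n} {S : Subset n} → j ≢ i → j ∈ S → j ∈ toggle i S
∈-toggle⁺ {i = i} {j} {S} j≢i j∈S =
  lookup⇒[]= j _ (≡.trans (lookup∘updateAt′ j i j≢i S) ([]=⇒lookup j∈S))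

∈-toggle⁻ : {i j : Fin n} {S : Subset n} → j ≢ i → j ∈ toggle i S → j ∈ S
∈-toggle⁻ {i = i} {j} {S} j≢i j∈S′ =
  lookup⇒[]= j _ (≡.trans (≡.sym (lookup∘updateAt′ j i j≢i S)) ([]=⇒lookup j∈S′))

∉-toggle⁺ : {i j : Fin n} {S : Subset n} → j ≢ i → j ∉ S → j ∉ toggle i S
∉-toggle⁺ j≢i j∉S = j∉S ∘ ∈-toggle⁻ j≢i

∈-toggle⇒≢ : {i j : Fin n} {S : Subset n} → i ∈ S → j ∈ toggle i S → j ≢ i
∈-toggle⇒≢ i∈S j∈S′ refl = ∉-toggle i∈S j∈S′

∣p∣≡1+∣toggle∣ : {i : Fin n} {p : Subset n} → i ∈ p → ∣ p ∣ ≡ ℕ.suc ∣ toggle i p ∣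
∣p∣≡1+∣toggle∣ {p = true ∷ p}  here        = refl
∣p∣≡1+∣toggle∣ {p = true ∷ p}  (there i∈p) = ≡.cong ℕ.suc (∣p∣≡1+∣toggle∣ i∈p)
∣p∣≡1+∣toggle∣ {p = false ∷ p} (there i∈p) = ∣p∣≡1+∣toggle∣ i∈p

toggle-∪ : {i : Fin n} {p q : Subset n} → i ∈ p → i ∉ q → toggle i p ∪ toggle i q ≡ p ∪ q
toggle-∪ {q = true ∷ q}  here i∉q = contradiction here i∉q
toggle-∪ {q = false ∷ q} here _   = refl
toggle-∪ {p = a ∷ p} {b ∷ q} (there i∈p) i∉q = ≡.cong ((a ∨ b) ∷_) (toggle-∪ i∈p (i∉q ∘ there))

∉p∪q⁻ : {x : Fin n} (p q : Subset n) → x ∉ p ∪ q → x ∉ p × x ∉ q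
∉p∪q⁻ p q x∉p∪q = x∉p∪q ∘ p⊆p∪q q , x∉p∪q ∘ q⊆p∪q p q

∣p∪q∣≤∣p∣+∣q∣ : (p q : Subset n) → ∣ p ∪ q ∣ ≤ ∣ p ∣ ℕ.+ ∣ q ∣
∣p∪q∣≤∣p∣+∣q∣ []          []          = z≤n
∣p∪q∣≤∣p∣+∣q∣ (true ∷ p)  (true ∷ q)  =
  s≤s (ℕ.≤-trans (∣p∪q∣≤∣p∣+∣q∣ p q) (ℕ.+-monoʳ-≤ ∣ p ∣ (ℕ.n≤1+n _)))
∣p∪q∣≤∣p∣+∣q∣ (true ∷ p)  (false ∷ q) = s≤s (∣p∪q∣≤∣p∣+∣q∣ p q)
∣p∪q∣≤∣p∣+∣q∣ (false ∷ p) (true ∷ q)  =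
  ≡.subst (ℕ.suc ∣ p ∪ q ∣ ≤_) (≡.sym (ℕ.+-suc ∣ p ∣ ∣ q ∣)) (s≤s (∣p∪q∣≤∣p∣+∣q∣ p q))
∣p∪q∣≤∣p∣+∣q∣ (false ∷ p) (false ∷ q) = ∣p∪q∣≤∣p∣+∣q∣ p q

x∉p⇒∣p∣<n : {x : Fin n} {p : Subset n} → x ∉ p → ∣ p ∣ < n
x∉p⇒∣p∣<n {n} {x} {p} x∉p =
  ≡.subst (∣ p ∣ <_) (∣⊤∣≡n n) (p⊂q⇒∣p∣<∣q∣ {q = ⊤} (⊆⊤ , x , ∈⊤ , x∉p))

∣p∣<n⇒∃∉ : {p : Subset n} → ∣ p ∣ < n → ∃ (_∉ p)
∣p∣<n⇒∃∉ {n} {p} ∣p∣<n = ¬∀⟶∃¬ n (_∈ p) (_∈? p) λ ∀∈ →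
  ℕ.<⇒≱ ∣p∣<n (≡.subst (_≤ ∣ p ∣) (∣⊤∣≡n n) (p⊆q⇒∣p∣≤∣q∣ {p = ⊤} λ {x} _ → ∀∈ x))

0<∣p∣⇒Nonempty : {p : Subset n} → 0 < ∣ p ∣ → Nonempty p
0<∣p∣⇒Nonempty {n} {p} 0<∣p∣ with nonempty? p
... | yes ne = ne
... | no ¬ne = contradiction (≡.trans (≡.cong ∣_∣ (Empty-unique ¬ne)) (∣⊥∣≡0 n)) (ℕ.>⇒≢ 0<∣p∣)

0<∣p∣+∣q∣⇒Nonempty[p∪q] : (p q : Subset n) → 0 < ∣ p ∣ ℕ.+ ∣ q ∣ → Nonempty (p ∪ q)
0<∣p∣+∣q∣⇒Nonempty[p∪q] p q 0<s with ∣ p ∣ in eq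
... | ℕ.zero  with x , x∈q ← 0<∣p∣⇒Nonempty 0<s = x , q⊆p∪q p q x∈q
... | ℕ.suc _ with x , x∈p ← 0<∣p∣⇒Nonempty (≡.subst (0 <_) (≡.sym eq) (s≤s z≤n)) = x , p⊆p∪q q x∈p

-- Boundary points of a subset of the cycle

IsBoundary : Subset n → Fin n → Set
IsBoundary C p = p ∉ C × next p ∈ C

isBoundary? : (C : Subset n) → Decidable (IsBoundary C)
isBoundary? C p = ¬? (p ∈? C) ×-dec (next p ∈? C)

boundary : Subset n → Maybe (Fin n)
boundary C with any? (isBoundary? C)
... | yes (p , _) = just p
... | no _        = nothing

boundary-sound : {C : Subset n} {p : Fin n} → boundary C ≡ just p → IsBoundary C p
boundary-sound {C = C} eq with any? (isBoundary? C)
boundary-sound refl | yes (p , isBoundary) = isBoundary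

boundary-exists : {C : Subset n} {x y : Fin n} → x ∈ C → y ∉ C → ∃ λ p → boundary C ≡ just p
boundary-exists {ℕ.suc _} {C} {x} {y} x∈C y∉C with any? (isBoundary? C)
... | yes (p , _) = p , refl
... | no ¬∃       = contradiction x∈C (next-closed⇒universal (_∉ C) ∉-closed y∉C x)
  where
  ∉-closed : ∀ p → p ∉ C → next p ∉ C
  ∉-closed p p∉C next∈C = ¬∃ (p , p∉C , next∈C)

-- Orderings of duplicate-free lists

module _ {A : Set} where

  data Before (x y : A) : List A → Set where
    first : ∀ {l} → y ∈ₗ l → Before x y (x ∷ l)
    later : ∀ {z l} → Before x y l → Before x y (z ∷ l)

  private variable
    a x y : A
    l p q : List A

  Before⇒∈ˡ : Before x y l → x ∈ₗ l
  Before⇒∈ˡ (first _) = here refl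
  Before⇒∈ˡ (later b) = there (Before⇒∈ˡ b)

  Before⇒∈ʳ : Before x y l → y ∈ₗ l
  Before⇒∈ʳ (first y∈l) = there y∈l
  Before⇒∈ʳ (later b)   = there (Before⇒∈ʳ b)

  Precedes⇒Before : Precedes x y l → Before x y l
  Precedes⇒Before ([]     , l₂ , l₃ , refl) = first (∈-++⁺ʳ l₂ (here refl))
  Precedes⇒Before (z ∷ l₁ , l₂ , l₃ , refl) = later (Precedes⇒Before (l₁ , l₂ , l₃ , refl))

  Before-asym : Unique l → Before x y l → ¬ Before y x l
  Before-asym u       (first y∈l) (first _)  = Unique[x∷xs]⇒x∉xs u y∈l
  Before-asym u       (first _)   (later b′) = Unique[x∷xs]⇒x∉xs u (Before⇒∈ʳ b′)
  Before-asym u       (later b)   (first _)  = Unique[x∷xs]⇒x∉xs u (Before⇒∈ʳ b)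
  Before-asym (_ ∷ u) (later b)   (later b′) = Before-asym u b b′

  ∈-++-∷⁺ : ∀ p → x ∈ₗ p ++ q → x ∈ₗ p ++ a ∷ q
  ∈-++-∷⁺ p x∈ with ∈-++⁻ p x∈
  ... | inj₁ x∈p = ∈-++⁺ˡ x∈p
  ... | inj₂ x∈q = ∈-++⁺ʳ p (there x∈q)

  ∈-++-∷⁻ : ∀ p → x ∈ₗ p ++ a ∷ q → x ≡ a ⊎ x ∈ₗ p ++ q
  ∈-++-∷⁻ p x∈ with ∈-++⁻ p x∈
  ... | inj₁ x∈p         = inj₂ (∈-++⁺ˡ x∈p)
  ... | inj₂ (here x≡a)  = inj₁ x≡a
  ... | inj₂ (there x∈q) = inj₂ (∈-++⁺ʳ p x∈q)

  Unique-++-∷⁻ : ∀ p → Unique (p ++ a ∷ q) → a ∉ₗ p ++ q × Unique (p ++ q)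
  Unique-++-∷⁻ []      u@(_ ∷ u′) = Unique[x∷xs]⇒x∉xs u , u′
  Unique-++-∷⁻ (z ∷ p) (z≢ ∷ u′)  =
    a∉ , All.tabulate (All.lookup z≢ ∘ ∈-++-∷⁺ p) ∷ proj₂ (Unique-++-∷⁻ p u′)
    where
    a∉ : _ ∉ₗ z ∷ p ++ _
    a∉ (here a≡z) = All.lookup z≢ (∈-++⁺ʳ p (here refl)) (≡.sym a≡z)
    a∉ (there a∈) = proj₁ (Unique-++-∷⁻ p u′) a∈

  Before-++⁺ˡ : Before x y p → Before x y (p ++ q)
  Before-++⁺ˡ (first y∈p) = first (∈-++⁺ˡ y∈p)
  Before-++⁺ˡ (later b)   = later (Before-++⁺ˡ b)

  Before-insert : ∀ p → Before x y (p ++ q) → Before x y (p ++ a ∷ q)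
  Before-insert []      b           = later b
  Before-insert (_ ∷ p) (first y∈l) = first (∈-++-∷⁺ p y∈l)
  Before-insert (_ ∷ p) (later b)   = later (Before-insert p b)

  ∈⇒Before-middle : x ∈ₗ p → Before x a (p ++ a ∷ q)
  ∈⇒Before-middle {p = _ ∷ p} (here refl) = first (∈-++⁺ʳ p (here refl))
  ∈⇒Before-middle {p = _ ∷ p} (there x∈p) = later (∈⇒Before-middle x∈p)

zipWith-applyUpTo : ∀ {a b d} {A : Set a} {B : Set b} {C : Set d} (F : A → B → C) (f : ℕ → A) (g : ℕ → B) k →
                    zipWith F (applyUpTo f k) (applyUpTo g k) ≡ applyUpTo (λ i → F (f i) (g i)) k
zipWith-applyUpTo F f g ℕ.zero    = refl
zipWith-applyUpTo F f g (ℕ.suc k) = ≡.cong (F (f 0) (g 0) ∷_) (zipWith-applyUpTo F (f ∘ ℕ.suc) (g ∘ ℕ.suc) k)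

module Reordering {c ℓ} (R : Ring c ℓ) {n} (u : Fin n → Ring.Carrier R) (_⋖_ : Fin n → Fin n → Set)
  (commute : ∀ x y → x ≢ y → ¬ x ⋖ y → ¬ y ⋖ x →
             Ring._≈_ R (Ring._*_ R (u x) (u y)) (Ring._*_ R (u y) (u x)))
  where

  open Ring R renaming (refl to ≈-refl)
  open import Relation.Binary.Reasoning.Setoid setoid

  Respects : List (Fin n) → Set
  Respects l = ∀ {x y} → x ⋖ y → x ∈ₗ l → y ∈ₗ l → Before x y l

  prodU-pull : ∀ {a} p q → (∀ {x} → x ∈ₗ p → u x * u a ≈ u a * u x) →
               prodU R u (p ++ a ∷ q) ≈ u a * prodU R u (p ++ q)
  prodU-pull         []      q _    = ≈-refl
  prodU-pull {a = a} (z ∷ p) q comm = begin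
    u z * prodU R u (p ++ a ∷ q)     ≈⟨ *-congˡ (prodU-pull p q (comm ∘ there)) ⟩
    u z * (u a * prodU R u (p ++ q)) ≈⟨ *-assoc _ _ _ ⟨
    (u z * u a) * prodU R u (p ++ q) ≈⟨ *-congʳ (comm (here refl)) ⟩
    (u a * u z) * prodU R u (p ++ q) ≈⟨ *-assoc _ _ _ ⟩
    u a * (u z * prodU R u (p ++ q)) ∎

  private
    -- Unlike `Respects`, this negative form passes to sublists, as the induction needs.
    NoInversion : List (Fin n) → Set
    NoInversion l = ∀ {x y} → x ⋖ y → ¬ Before y x l

    Respects⇒NoInversion : ∀ {l} → Unique l → Respects l → NoInversion l
    Respects⇒NoInversion u-l resp x⋖y b = Before-asym u-l (resp x⋖y (Before⇒∈ʳ b) (Before⇒∈ˡ b)) b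

    reorder : ∀ {l l′} → Unique l → Unique l′ → l ⊆ₗ l′ → l′ ⊆ₗ l →
              NoInversion l → NoInversion l′ → prodU R u l ≈ prodU R u l′
    reorder {[]}    {[]} _ _ _    _ _ _ = ≈-refl
    reorder {_ ∷ _} {[]} _ _ l⊆l′ _ _ _ with () ← l⊆l′ (here refl)
    reorder {l} {a ∷ l₀} u-l u-l′@(_ ∷ u-l₀) l⊆l′ l′⊆l ni ni′
      with p , q , refl ← ∈-∃++ (l′⊆l (here refl)) = begin
      prodU R u (p ++ a ∷ q)   ≈⟨ prodU-pull p q commutes ⟩
      u a * prodU R u (p ++ q) ≈⟨ *-congˡ (reorder u-pq u-l₀ pq⊆l₀ l₀⊆pq
                                    (λ x⋖y → ni x⋖y ∘ Before-insert p) (λ x⋖y → ni′ x⋖y ∘ later)) ⟩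
      u a * prodU R u l₀       ∎
      where
      a∉pq = proj₁ (Unique-++-∷⁻ p u-l)
      u-pq = proj₂ (Unique-++-∷⁻ p u-l)
      pq⊆l₀ : p ++ q ⊆ₗ l₀
      pq⊆l₀ x∈pq with l⊆l′ (∈-++-∷⁺ p x∈pq)
      ... | here refl  = contradiction x∈pq a∉pq
      ... | there x∈l₀ = x∈l₀
      l₀⊆pq : l₀ ⊆ₗ p ++ q
      l₀⊆pq x∈l₀ with ∈-++-∷⁻ p (l′⊆l (there x∈l₀))
      ... | inj₁ refl = contradiction x∈l₀ (Unique[x∷xs]⇒x∉xs u-l′)
      ... | inj₂ x∈pq = x∈pq
      commutes : ∀ {x} → x ∈ₗ p → u x * u a ≈ u a * u x
      commutes {x} x∈p = commute x a x≢a
        (λ x⋖a → ni′ x⋖a (first (pq⊆l₀ (∈-++⁺ˡ x∈p))))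
        (λ a⋖x → ni a⋖x (∈⇒Before-middle x∈p))
        where
        x≢a : x ≢ a
        x≢a refl = a∉pq (∈-++⁺ˡ x∈p)

  prodU-reorder : ∀ {l l′} → Unique l → Unique l′ → l ⊆ₗ l′ → l′ ⊆ₗ l →
                  Respects l → Respects l′ → prodU R u l ≈ prodU R u l′
  prodU-reorder u-l u-l′ l⊆l′ l′⊆l resp resp′ =
    reorder u-l u-l′ l⊆l′ l′⊆l (Respects⇒NoInversion u-l resp) (Respects⇒NoInversion u-l′ resp′)

  prodU-enumerations : ∀ {A : Subset n} {l l′} → Enumerates A l → Enumerates A l′ →
                       Respects l → Respects l′ → prodU R u l ≈ prodU R u l′
  prodU-enumerations (u-l , mem) (u-l′ , mem′) =
    prodU-reorder u-l u-l′ (λ {a} a∈l → proj₁ (mem′ a) (proj₂ (mem a) a∈l))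
                           (λ {a} a∈l′ → proj₁ (mem a) (proj₂ (mem′ a) a∈l′))

enumerates-snoc : {i : Fin n} {B : Subset n} {l : List (Fin n)} →
                  i ∈ B → Enumerates (toggle i B) l → Enumerates B (l ++ [ i ])
enumerates-snoc {i = i} {B} {l} i∈B (u-l , mem) = ++⁺ u-l ([] ∷ []) disjoint , mem′
  where
  disjoint : ∀ {a} → ¬ (a ∈ₗ l × a ∈ₗ [ i ])
  disjoint (i∈l , here refl) = ∉-toggle i∈B (proj₂ (mem i) i∈l)
  mem′ : ∀ a → (a ∈ B → a ∈ₗ l ++ [ i ]) × (a ∈ₗ l ++ [ i ] → a ∈ B)
  mem′ a = to , from
    where
    to : a ∈ B → a ∈ₗ l ++ [ i ]
    to a∈B with a ≟ i
    ... | yes refl = ∈-++⁺ʳ l (here refl)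
    ... | no a≢i   = ∈-++⁺ˡ (proj₁ (mem a) (∈-toggle⁺ a≢i a∈B))
    from : a ∈ₗ l ++ [ i ] → a ∈ B
    from a∈l′ with ∈-++⁻ l a∈l′
    ... | inj₂ (here refl) = i∈B
    ... | inj₁ a∈l         = ∈-toggle⁻ (∈-toggle⇒≢ i∈B a∈B′) a∈B′
      where a∈B′ = proj₂ (mem a) a∈l

enumerates-cons : {i : Fin n} {A : Subset n} {l : List (Fin n)} →
                  i ∈ A → Enumerates (toggle i A) l → Enumerates A (i ∷ l)
enumerates-cons {i = i} {A} {l} i∈A (u-l , mem) = All.tabulate i≢ ∷ u-l , mem′
  where
  i≢ : ∀ {a} → a ∈ₗ l → i ≢ a
  i≢ a∈l i≡a = ∈-toggle⇒≢ i∈A (proj₂ (mem _) a∈l) (≡.sym i≡a)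
  mem′ : ∀ a → (a ∈ A → a ∈ₗ i ∷ l) × (a ∈ₗ i ∷ l → a ∈ A)
  mem′ a = to , from
    where
    to : a ∈ A → a ∈ₗ i ∷ l
    to a∈A with a ≟ i
    ... | yes refl = here refl
    ... | no a≢i   = there (proj₁ (mem a) (∈-toggle⁺ a≢i a∈A))
    from : a ∈ₗ i ∷ l → a ∈ A
    from (here refl) = i∈A
    from (there a∈l) = ∈-toggle⁻ (∈-toggle⇒≢ i∈A a∈A′) a∈A′
      where a∈A′ = proj₂ (mem a) a∈l

enumerates-⊥ : {l : List (Fin n)} → Enumerates ⊥ l → l ≡ []
enumerates-⊥ {l = []}    _         = refl
enumerates-⊥ {l = a ∷ l} (_ , mem) = contradiction (proj₂ (mem a) (here refl)) ∉⊥

-- Finite sums in a ring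

module Sums {c ℓ} (R : Ring c ℓ) where

  open Ring R hiding (zero) renaming (refl to ≈-refl)
  open import Algebra.Properties.Ring R using (-0#≈0#; -‿+-comm)
  open import Algebra.Properties.CommutativeSemigroup +-commutativeSemigroup using (interchange)
  open import Relation.Binary.Reasoning.Setoid setoid

  ∑ : {X : Set} → List X → (X → Carrier) → Carrier
  ∑ xs f = sumR R (map f xs)

  syntax ∑ xs (λ x → e) = ∑[ x ∈ xs ] e

  -- With these, `sumSubsets R n k f` unfolds to `∑[ A ∈ allSubsets n ] when (does (∣ A ∣ ≟ k)) (f A)`.
  when : Bool → Carrier → Carrier
  when b x = if b then x else 0#

  private variable
    X Y : Set
    xs ys : List X
    f g : X → Carrier

  ∑-cong : ∀ xs → (∀ x → f x ≈ g x) → ∑ xs f ≈ ∑ xs g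
  ∑-cong []       f≈g = ≈-refl
  ∑-cong (x ∷ xs) f≈g = +-cong (f≈g x) (∑-cong xs f≈g)

  ∑-zero : ∀ xs → (∀ x → f x ≈ 0#) → ∑ xs f ≈ 0#
  ∑-zero []       f≈0 = ≈-refl
  ∑-zero (x ∷ xs) f≈0 = trans (+-cong (f≈0 x) (∑-zero xs f≈0)) (+-identityˡ 0#)

  ∑-++ : ∀ xs → ∑ (xs ++ ys) f ≈ ∑ xs f + ∑ ys f
  ∑-++ []       = sym (+-identityˡ _)
  ∑-++ (x ∷ xs) = trans (+-congˡ (∑-++ xs)) (sym (+-assoc _ _ _))

  ∑-map : (h : X → Y) (xs : List X) → ∑ (map h xs) f ≡ ∑ xs (f ∘ h)
  ∑-map h []       = refl
  ∑-map h (x ∷ xs) = ≡.cong (_ +_) (∑-map h xs)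

  ∑-distrib-+ : ∀ xs → ∑ xs (λ x → f x + g x) ≈ ∑ xs f + ∑ xs g
  ∑-distrib-+ []       = sym (+-identityˡ 0#)
  ∑-distrib-+ (x ∷ xs) = trans (+-congˡ (∑-distrib-+ xs)) (interchange _ _ _ _)

  ∑-distribˡ : ∀ xs a → a * ∑ xs f ≈ ∑ xs (λ x → a * f x)
  ∑-distribˡ []       a = zeroʳ a
  ∑-distribˡ (x ∷ xs) a = trans (distribˡ a _ _) (+-congˡ (∑-distribˡ xs a))

  ∑-distribʳ : ∀ xs a → ∑ xs f * a ≈ ∑ xs (λ x → f x * a)
  ∑-distribʳ []       a = zeroˡ a
  ∑-distribʳ (x ∷ xs) a = trans (distribʳ a _ _) (+-congˡ (∑-distribʳ xs a))

  -‿∑ : ∀ xs → - ∑ xs f ≈ ∑ xs (λ x → - f x)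
  -‿∑ []       = -0#≈0#
  -‿∑ (x ∷ xs) = trans (sym (-‿+-comm _ _)) (+-congˡ (-‿∑ xs))

  ∑-comm : ∀ xs ys (h : X → Y → Carrier) →
           ∑[ x ∈ xs ] ∑[ y ∈ ys ] h x y ≈ ∑[ y ∈ ys ] ∑[ x ∈ xs ] h x y
  ∑-comm []       ys h = sym (∑-zero ys (λ _ → ≈-refl))
  ∑-comm (x ∷ xs) ys h = trans (+-congˡ (∑-comm xs ys h)) (sym (∑-distrib-+ ys))

  ∑-upTo-suc : ∀ n (f : ℕ → Carrier) → ∑ (upTo (ℕ.suc n)) f ≡ f 0 + ∑ (upTo n) (f ∘ ℕ.suc)
  ∑-upTo-suc n f =
    ≡.cong (sumR R) (≡.trans (map-upTo f (ℕ.suc n)) (≡.cong (f 0 ∷_) (≡.sym (map-upTo (f ∘ ℕ.suc) n))))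

  *-when : ∀ b x y → x * when b y ≈ when b (x * y)
  *-when true  x y = ≈-refl
  *-when false x y = zeroʳ x

  when-* : ∀ b x y → when b x * y ≈ when b (x * y)
  when-* true  x y = ≈-refl
  when-* false x y = zeroˡ y

  when-≈0 : ∀ b {x} → x ≈ 0# → when b x ≈ 0#
  when-≈0 true  x≈0 = x≈0
  when-≈0 false _   = ≈-refl

  when-dec-≈0 : ∀ {P : Set} (P? : Dec P) {x} → (P → x ≈ 0#) → when (does P?) x ≈ 0#
  when-dec-≈0 (yes p) x≈0 = x≈0 p
  when-dec-≈0 (no _)  _   = ≈-refl

  when-dec-cancel : ∀ {P : Set} (P? : Dec P) {x y} → (P → x + y ≈ 0#) →
                    when (does P?) x + when (does P?) y ≈ 0#
  when-dec-cancel (yes p) x+y≈0 = x+y≈0 p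
  when-dec-cancel (no _)  _     = +-identityʳ 0#

  when-dec-⇔ : ∀ {P Q : Set} (P? : Dec P) (Q? : Dec Q) {x} → (P → Q) → (Q → P) →
               when (does P?) x ≈ when (does Q?) x
  when-dec-⇔ (yes _) (yes _) _   _   = ≈-refl
  when-dec-⇔ (no _)  (no _)  _   _   = ≈-refl
  when-dec-⇔ (yes p) (no ¬q) p⇒q _   = contradiction (p⇒q p) ¬q
  when-dec-⇔ (no ¬p) (yes q) _   q⇒p = contradiction (q⇒p q) ¬p

  module _ {X : Set} (_≟_ : DecidableEquality X) where

    when-≟-subst : ∀ q p (h : X → Carrier) → when (does (q ≟ p)) (h p) ≈ when (does (q ≟ p)) (h q)
    when-≟-subst q p h with q ≟ p
    ... | yes refl = ≈-refl
    ... | no _     = ≈-refl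

    ∑-when-≟-∉ : ∀ (f : X → Carrier) {q} xs → q ∉ₗ xs → ∑[ p ∈ xs ] when (does (q ≟ p)) (f p) ≈ 0#
    ∑-when-≟-∉ f     []       _  = ≈-refl
    ∑-when-≟-∉ f {q} (x ∷ xs) q∉ with q ≟ x
    ... | yes refl = contradiction (here refl) q∉
    ... | no _     = trans (+-identityˡ _) (∑-when-≟-∉ f xs (q∉ ∘ there))

    ∑-when-≟ : ∀ (f : X → Carrier) {q} xs → Unique xs → q ∈ₗ xs →
               ∑[ p ∈ xs ] when (does (q ≟ p)) (f p) ≈ f q
    ∑-when-≟ f {q} (x ∷ xs) u@(_ ∷ u′) q∈ with q ≟ x | q∈
    ... | yes refl | _          = trans (+-congˡ (∑-when-≟-∉ f xs (Unique[x∷xs]⇒x∉xs u))) (+-identityʳ _)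
    ... | no q≢x   | here q≡x   = contradiction q≡x q≢x
    ... | no _     | there q∈xs = trans (+-identityˡ _) (∑-when-≟ f xs u′ q∈xs)

  ∑-allSubsets-suc : ∀ n (F : Subset (ℕ.suc n) → Carrier) →
                     ∑ (allSubsets (ℕ.suc n)) F ≈
                     ∑[ S ∈ allSubsets n ] F (inside ∷ S) + ∑[ S ∈ allSubsets n ] F (outside ∷ S)
  ∑-allSubsets-suc n F = trans (∑-++ (map (inside ∷_) Ss))
    (+-cong (reflexive (∑-map (inside ∷_) Ss)) (reflexive (∑-map (outside ∷_) Ss)))
    where Ss = allSubsets n

  ∑-toggle : ∀ {n} (i : Fin n) (F : Subset n → Carrier) →
             ∑ (allSubsets n) F ≈ ∑[ S ∈ allSubsets n ] F (toggle i S)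
  ∑-toggle {ℕ.suc n} zero F = begin
    ∑ (allSubsets (ℕ.suc n)) F                           ≈⟨ ∑-allSubsets-suc n F ⟩
    ∑[ S ∈ Ss ] F (inside ∷ S) + ∑[ S ∈ Ss ] F (outside ∷ S) ≈⟨ +-comm _ _ ⟩
    ∑[ S ∈ Ss ] F (outside ∷ S) + ∑[ S ∈ Ss ] F (inside ∷ S) ≈⟨ ∑-allSubsets-suc n _ ⟨
    ∑[ S ∈ allSubsets (ℕ.suc n) ] F (toggle zero S)      ∎
    where Ss = allSubsets n
  ∑-toggle {ℕ.suc n} (suc i) F = begin
    ∑ (allSubsets (ℕ.suc n)) F                           ≈⟨ ∑-allSubsets-suc n F ⟩
    ∑[ S ∈ Ss ] F (inside ∷ S) + ∑[ S ∈ Ss ] F (outside ∷ S) ≈⟨ +-cong (∑-toggle i _) (∑-toggle i _) ⟩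
    ∑[ S ∈ Ss ] F (inside ∷ toggle i S) + ∑[ S ∈ Ss ] F (outside ∷ toggle i S) ≈⟨ ∑-allSubsets-suc n _ ⟨
    ∑[ S ∈ allSubsets (ℕ.suc n) ] F (toggle (suc i) S)   ∎
    where Ss = allSubsets n

  ∑-when-∣∣≡0 : ∀ n (F : Subset n → Carrier) →
                ∑[ S ∈ allSubsets n ] when (does (∣ S ∣ ℕ.≟ 0)) (F S) ≈ F ⊥
  ∑-when-∣∣≡0 ℕ.zero    F = +-identityʳ _
  ∑-when-∣∣≡0 (ℕ.suc n) F = begin
    ∑[ S ∈ allSubsets (ℕ.suc n) ] when (does (∣ S ∣ ℕ.≟ 0)) (F S)            ≈⟨ ∑-allSubsets-suc n _ ⟩
    ∑[ S ∈ Ss ] 0# + ∑[ S ∈ Ss ] when (does (∣ S ∣ ℕ.≟ 0)) (F (outside ∷ S))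
      ≈⟨ +-cong (∑-zero Ss (λ _ → ≈-refl)) (∑-when-∣∣≡0 n (F ∘ (outside ∷_))) ⟩
    0# + F ⊥                                                                ≈⟨ +-identityˡ _ ⟩
    F ⊥                                                                     ∎
    where Ss = allSubsets n

  module _ {n : ℕ} (N : ℕ) (γ : ℕ → Carrier) (F G : Subset n → Carrier) where

    private
      Ss = allSubsets n
      js = upTo (ℕ.suc N)

      term : ℕ → Subset n → Subset n → Carrier
      term j B A = γ j * (when (does (∣ B ∣ ℕ.≟ j)) (F B) * when (does (∣ A ∣ ℕ.≟ N ∸ j)) (G A))

      term∣B∣ : Subset n → Subset n → Carrier
      term∣B∣ B A = γ ∣ B ∣ * (F B * when (does (∣ A ∣ ℕ.≟ N ∸ ∣ B ∣)) (G A))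

      term≈ : ∀ j B A → term j B A ≈ when (does (∣ B ∣ ℕ.≟ j)) (term∣B∣ B A)
      term≈ j B A = begin
        γ j * (when (does (∣ B ∣ ℕ.≟ j)) (F B) * when (does (∣ A ∣ ℕ.≟ N ∸ j)) (G A))  ≈⟨ *-congˡ (when-* _ _ _) ⟩
        γ j * when (does (∣ B ∣ ℕ.≟ j)) (F B * when (does (∣ A ∣ ℕ.≟ N ∸ j)) (G A))    ≈⟨ *-when _ _ _ ⟩
        when (does (∣ B ∣ ℕ.≟ j)) (γ j * (F B * when (does (∣ A ∣ ℕ.≟ N ∸ j)) (G A)))
          ≈⟨ when-≟-subst ℕ._≟_ ∣ B ∣ j (λ k → γ k * (F B * when (does (∣ A ∣ ℕ.≟ N ∸ k)) (G A))) ⟩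
        when (does (∣ B ∣ ℕ.≟ j)) (term∣B∣ B A)                                         ∎

      term∣B∣≈ : ∀ B A → ∣ B ∣ ≤ N →
                 term∣B∣ B A ≈ when (does (∣ A ∣ ℕ.+ ∣ B ∣ ℕ.≟ N)) (γ ∣ B ∣ * (F B * G A))
      term∣B∣≈ B A ∣B∣≤N = begin
        γ ∣ B ∣ * (F B * when (does (∣ A ∣ ℕ.≟ N ∸ ∣ B ∣)) (G A)) ≈⟨ *-congˡ (*-when _ _ _) ⟩
        γ ∣ B ∣ * when (does (∣ A ∣ ℕ.≟ N ∸ ∣ B ∣)) (F B * G A)   ≈⟨ *-when _ _ _ ⟩
        when (does (∣ A ∣ ℕ.≟ N ∸ ∣ B ∣)) (γ ∣ B ∣ * (F B * G A))
          ≈⟨ when-dec-⇔ (∣ A ∣ ℕ.≟ N ∸ ∣ B ∣) (∣ A ∣ ℕ.+ ∣ B ∣ ℕ.≟ N)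
               (λ e → ≡.trans (≡.cong (ℕ._+ ∣ B ∣) e) (ℕ.m∸n+n≡m ∣B∣≤N))
               (λ e → ≡.trans (≡.sym (ℕ.m+n∸n≡m ∣ A ∣ ∣ B ∣)) (≡.cong (_∸ ∣ B ∣) e)) ⟩
        when (does (∣ A ∣ ℕ.+ ∣ B ∣ ℕ.≟ N)) (γ ∣ B ∣ * (F B * G A)) ∎

      ∑-term : ∀ B A → ∑[ j ∈ js ] term j B A ≈
                       when (does (∣ A ∣ ℕ.+ ∣ B ∣ ℕ.≟ N)) (γ ∣ B ∣ * (F B * G A))
      ∑-term B A with ∣ B ∣ ℕ.≤? N
      ... | yes ∣B∣≤N = begin
        ∑[ j ∈ js ] term j B A                                   ≈⟨ ∑-cong js (λ j → term≈ j B A) ⟩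
        ∑[ j ∈ js ] when (does (∣ B ∣ ℕ.≟ j)) (term∣B∣ B A)
          ≈⟨ ∑-when-≟ ℕ._≟_ (λ _ → term∣B∣ B A) js (upTo⁺ _) (∈-upTo⁺ (s≤s ∣B∣≤N)) ⟩
        term∣B∣ B A                                             ≈⟨ term∣B∣≈ B A ∣B∣≤N ⟩
        when (does (∣ A ∣ ℕ.+ ∣ B ∣ ℕ.≟ N)) (γ ∣ B ∣ * (F B * G A)) ∎
      ... | no ∣B∣≰N = begin
        ∑[ j ∈ js ] term j B A                                   ≈⟨ ∑-cong js (λ j → term≈ j B A) ⟩
        ∑[ j ∈ js ] when (does (∣ B ∣ ℕ.≟ j)) (term∣B∣ B A)
          ≈⟨ ∑-when-≟-∉ ℕ._≟_ (λ _ → term∣B∣ B A) js (∣B∣≰N ∘ ℕ.s≤s⁻¹ ∘ ∈-upTo⁻) ⟩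
        0#
          ≈⟨ when-dec-≈0 (∣ A ∣ ℕ.+ ∣ B ∣ ℕ.≟ N)
               (λ e → ⊥-elim (∣B∣≰N (≡.subst (∣ B ∣ ≤_) e (ℕ.m≤n+m ∣ B ∣ ∣ A ∣)))) ⟨
        when (does (∣ A ∣ ℕ.+ ∣ B ∣ ℕ.≟ N)) (γ ∣ B ∣ * (F B * G A)) ∎

      expand : ∀ j → γ j * (sumSubsets R n j F * sumSubsets R n (N ∸ j) G) ≈
                     ∑[ B ∈ Ss ] ∑[ A ∈ Ss ] term j B A
      expand j = begin
        γ j * (sumSubsets R n j F * sumSubsets R n (N ∸ j) G)
          ≈⟨ *-congˡ (∑-distribʳ Ss _) ⟩
        γ j * ∑[ B ∈ Ss ] (when (does (∣ B ∣ ℕ.≟ j)) (F B) * sumSubsets R n (N ∸ j) G)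
          ≈⟨ ∑-distribˡ Ss _ ⟩
        ∑[ B ∈ Ss ] (γ j * (when (does (∣ B ∣ ℕ.≟ j)) (F B) * sumSubsets R n (N ∸ j) G))
          ≈⟨ ∑-cong Ss (λ B → *-congˡ (∑-distribˡ Ss _)) ⟩
        ∑[ B ∈ Ss ] (γ j * ∑[ A ∈ Ss ] (when (does (∣ B ∣ ℕ.≟ j)) (F B) * when (does (∣ A ∣ ℕ.≟ N ∸ j)) (G A)))
          ≈⟨ ∑-cong Ss (λ B → ∑-distribˡ Ss _) ⟩
        ∑[ B ∈ Ss ] ∑[ A ∈ Ss ] term j B A
          ∎

    sumSubsets-convolution :
      ∑[ j ∈ upTo (ℕ.suc N) ] (γ j * (sumSubsets R n j F * sumSubsets R n (N ∸ j) G)) ≈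
      ∑[ B ∈ allSubsets n ] ∑[ A ∈ allSubsets n ] when (does (∣ A ∣ ℕ.+ ∣ B ∣ ℕ.≟ N)) (γ ∣ B ∣ * (F B * G A))
    sumSubsets-convolution = begin
      ∑[ j ∈ js ] (γ j * (sumSubsets R n j F * sumSubsets R n (N ∸ j) G)) ≈⟨ ∑-cong js expand ⟩
      ∑[ j ∈ js ] ∑[ B ∈ Ss ] ∑[ A ∈ Ss ] term j B A                      ≈⟨ ∑-comm js Ss _ ⟩
      ∑[ B ∈ Ss ] ∑[ j ∈ js ] ∑[ A ∈ Ss ] term j B A                      ≈⟨ ∑-cong Ss (λ B → ∑-comm js Ss _) ⟩
      ∑[ B ∈ Ss ] ∑[ A ∈ Ss ] ∑[ j ∈ js ] term j B A                      ≈⟨ ∑-cong Ss (λ B → ∑-cong Ss (∑-term B)) ⟩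
      ∑[ B ∈ Ss ] ∑[ A ∈ Ss ] when (does (∣ A ∣ ℕ.+ ∣ B ∣ ℕ.≟ N)) (γ ∣ B ∣ * (F B * G A)) ∎

-- The alternating sum over pairs of subsets

module _ {c ℓ} (R : Ring c ℓ) {n} (2≤n : 2 ≤ n) (u : Fin n → Ring.Carrier R) (rel : Relations R n u)
  (σ : Subset n → List (Fin n)) (hσ : (A : Subset n) → ∣ A ∣ < n → HOrder A (σ A))
  (τ : Subset n → List (Fin n)) (hτ : (A : Subset n) → ∣ A ∣ < n → EOrder A (τ A))
  where

  open Ring R renaming (refl to ≈-refl)
  open import Algebra.Properties.Ring R using (-‿distribˡ-*; x∙y⁻¹≈ε⇒x≈y)
  open Sums R
  open import Relation.Binary.Reasoning.Setoid setoid

  private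
    distant-commute : ∀ x y → x ≢ y → y ≢ next x → x ≢ next y → u x * u y ≈ u y * u x
    distant-commute = proj₂ (proj₂ rel)

    module H = Reordering R u (λ x y → x ≡ next y)
                 (λ x y x≢y ¬x⋖y ¬y⋖x → distant-commute x y x≢y ¬y⋖x ¬x⋖y)
    module E = Reordering R u (λ x y → y ≡ next x) distant-commute

  HOrder⇒Respects : ∀ {A l} → HOrder A l → H.Respects l
  HOrder⇒Respects ((_ , mem) , prec) {y = y} refl x∈l y∈l =
    Precedes⇒Before (prec y (proj₂ (mem y) y∈l) (proj₂ (mem _) x∈l))

  EOrder⇒Respects : ∀ {A l} → EOrder A l → E.Respects l
  EOrder⇒Respects ((_ , mem) , prec) {x = x} refl x∈l y∈l =
    Precedes⇒Before (prec x (proj₂ (mem x) x∈l) (proj₂ (mem _) y∈l))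

  prodU-snoc : ∀ l i → prodU R u (l ++ [ i ]) ≈ prodU R u l * u i
  prodU-snoc []      i = trans (*-identityʳ _) (sym (*-identityˡ _))
  prodU-snoc (x ∷ l) i = trans (*-congˡ (prodU-snoc l i)) (sym (*-assoc _ _ _))

  uₕ uₑ : Subset n → Carrier
  uₕ B = prodU R u (σ B)
  uₑ A = prodU R u (τ A)

  module _ {p : Fin n} {S : Subset n} (i∈S : next p ∈ S) (p∉S : p ∉ S) where
    private
      i = next p
      S₀ = toggle i S
      p∉S₀ : p ∉ S₀
      p∉S₀ = ∉-toggle⁺ (next-irreflexive 2≤n p ∘ ≡.sym) p∉S

    uₕ-split : uₕ S ≈ uₕ S₀ * u i
    uₕ-split = begin
      prodU R u (σ S)           ≈⟨ H.prodU-enumerations (proj₁ hS) (enumerates-snoc i∈S (proj₁ h₀))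
                                     (HOrder⇒Respects hS) respects ⟩
      prodU R u (σ S₀ ++ [ i ]) ≈⟨ prodU-snoc (σ S₀) i ⟩
      prodU R u (σ S₀) * u i    ∎
      where
      hS = hσ S (x∉p⇒∣p∣<n p∉S)
      h₀ = hσ S₀ (x∉p⇒∣p∣<n p∉S₀)
      respects : H.Respects (σ S₀ ++ [ i ])
      respects {y = y} refl x∈l y∈l with ∈-++⁻ (σ S₀) x∈l | ∈-++⁻ (σ S₀) y∈l
      ... | inj₁ x∈l₀        | inj₁ y∈l₀        = Before-++⁺ˡ (HOrder⇒Respects h₀ refl x∈l₀ y∈l₀)
      ... | inj₁ x∈l₀        | inj₂ (here refl) = ∈⇒Before-middle x∈l₀
      ... | inj₂ (here y⁺≡i) | inj₁ y∈l₀        =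
        contradiction (≡.subst (_∈ S₀) (next-injective y⁺≡i) (proj₂ (proj₂ (proj₁ h₀) y) y∈l₀)) p∉S₀
      ... | inj₂ (here i⁺≡i) | inj₂ (here refl) = contradiction i⁺≡i (next-irreflexive 2≤n i)

    uₑ-split : uₑ S ≈ u i * uₑ S₀
    uₑ-split = E.prodU-enumerations (proj₁ hS) (enumerates-cons i∈S (proj₁ h₀)) (EOrder⇒Respects hS) respects
      where
      hS = hτ S (x∉p⇒∣p∣<n p∉S)
      h₀ = hτ S₀ (x∉p⇒∣p∣<n p∉S₀)
      respects : E.Respects (i ∷ τ S₀)
      respects         refl (here refl)  (here i⁺≡i)  = contradiction i⁺≡i (next-irreflexive 2≤n i)
      respects         refl (here refl)  (there y∈l₀) = first y∈l₀
      respects {x = x} refl (there x∈l₀) (here x⁺≡i)  =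
        contradiction (≡.subst (_∈ S₀) (next-injective x⁺≡i) (proj₂ (proj₂ (proj₁ h₀) x) x∈l₀)) p∉S₀
      respects         refl (there x∈l₀) (there y∈l₀) = later (EOrder⇒Respects h₀ refl x∈l₀ y∈l₀)

  private
    _≟ₘ_ : DecidableEquality (Maybe (Fin n))
    _≟ₘ_ = Maybe.≡-dec _≟_

  ∑-when-just : ∀ m x → (m ≡ nothing → x ≈ 0#) → ∑[ p ∈ allFin n ] when (does (m ≟ₘ just p)) x ≈ x
  ∑-when-just (just q) x _   = ∑-when-≟ _≟_ (λ _ → x) (allFin n) (allFin⁺ n) (∈-allFin q)
  ∑-when-just nothing  x x≈0 = trans (∑-zero (allFin n) (λ _ → ≈-refl)) (sym (x≈0 refl))

  module _ (N : ℕ) where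

    w : Subset n → Subset n → Carrier
    w B A = when (does (∣ A ∣ ℕ.+ ∣ B ∣ ℕ.≟ N)) (sgn R ∣ B ∣ * (uₕ B * uₑ A))

    -- For fixed p, the pairs counted by G p are matched by toggling next p in both subsets.
    G : Fin n → Subset n → Subset n → Carrier
    G p B A = when (does (boundary (A ∪ B) ≟ₘ just p)) (w B A)

    module _ (p : Fin n) where
      private
        i = next p

      G-vanishes : ∀ {B A} → (IsBoundary (A ∪ B) p → w B A ≈ 0#) → G p B A ≈ 0#
      G-vanishes {B} {A} w≈0 = when-dec-≈0 (boundary (A ∪ B) ≟ₘ just p) (w≈0 ∘ boundary-sound)

      G-both-in : ∀ {B A} → i ∈ B → i ∈ A → G p B A ≈ 0#
      G-both-in {B} {A} i∈B i∈A = G-vanishes λ (p∉A∪B , _) →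
        let p∉A , p∉B = ∉p∪q⁻ A B p∉A∪B in
        when-≈0 _ (trans (*-congˡ (begin
          uₕ B * uₑ A                                       ≈⟨ *-cong (uₕ-split i∈B p∉B) (uₑ-split i∈A p∉A) ⟩
          (uₕ (toggle i B) * u i) * (u i * uₑ (toggle i A)) ≈⟨ *-assoc _ _ _ ⟩
          uₕ (toggle i B) * (u i * (u i * uₑ (toggle i A))) ≈⟨ *-congˡ (*-assoc _ _ _) ⟨
          uₕ (toggle i B) * ((u i * u i) * uₑ (toggle i A)) ≈⟨ *-congˡ (*-congʳ (proj₁ rel i)) ⟩
          uₕ (toggle i B) * (0# * uₑ (toggle i A))          ≈⟨ *-congˡ (zeroˡ _) ⟩
          uₕ (toggle i B) * 0#                              ≈⟨ zeroʳ _ ⟩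
          0#                                                ∎)) (zeroʳ _))

      G-neither : ∀ {B A} → i ∉ B → i ∉ A → G p B A ≈ 0#
      G-neither {B} {A} i∉B i∉A =
        G-vanishes λ (_ , i∈A∪B) → ⊥-elim (Sum.[ i∉A , i∉B ] (x∈p∪q⁻ A B i∈A∪B))

      w-pair-cancel : ∀ {B A} → i ∉ B → i ∈ A → p ∉ B → p ∉ A →
                      w (toggle i B) (toggle i A) + w B A ≈ 0#
      w-pair-cancel {B} {A} i∉B i∈A p∉B p∉A = begin
        w B′ A′ + w B A
          ≡⟨ ≡.cong₂ (λ k b → when (does (k ℕ.≟ N)) (sgn R b * (uₕ B′ * uₑ A′)) + w B A) size≡ ∣B′∣≡ ⟩
        when (does (∣ A ∣ ℕ.+ ∣ B ∣ ℕ.≟ N)) (- s * (uₕ B′ * uₑ A′)) + w B A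
          ≈⟨ when-dec-cancel (∣ A ∣ ℕ.+ ∣ B ∣ ℕ.≟ N) (λ _ → terms-cancel) ⟩
        0# ∎
        where
        B′ = toggle i B
        A′ = toggle i A
        s = sgn R ∣ B ∣
        ∣B′∣≡ : ∣ B′ ∣ ≡ ℕ.suc ∣ B ∣
        ∣B′∣≡ = ≡.trans (∣p∣≡1+∣toggle∣ (∈-toggle i∉B))
                        (≡.cong (ℕ.suc ∘ ∣_∣) (toggle-involutive i B))
        size≡ : ∣ A′ ∣ ℕ.+ ∣ B′ ∣ ≡ ∣ A ∣ ℕ.+ ∣ B ∣
        size≡ = ≡.trans (≡.cong (∣ A′ ∣ ℕ.+_) ∣B′∣≡)
                (≡.trans (ℕ.+-suc ∣ A′ ∣ ∣ B ∣) (≡.cong (ℕ._+ ∣ B ∣) (≡.sym (∣p∣≡1+∣toggle∣ i∈A))))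
        uₕB′≈ : uₕ B′ ≈ uₕ B * u i
        uₕB′≈ = trans (uₕ-split (∈-toggle i∉B) (∉-toggle⁺ (next-irreflexive 2≤n p ∘ ≡.sym) p∉B))
                      (*-congʳ (reflexive (≡.cong uₕ (toggle-involutive i B))))
        t = uₕ B * (u i * uₑ A′)
        terms-cancel : - s * (uₕ B′ * uₑ A′) + s * (uₕ B * uₑ A) ≈ 0#
        terms-cancel = begin
          - s * (uₕ B′ * uₑ A′) + s * (uₕ B * uₑ A)
            ≈⟨ +-cong (*-congˡ (*-congʳ uₕB′≈)) (*-congˡ (*-congˡ (uₑ-split i∈A p∉A))) ⟩
          - s * ((uₕ B * u i) * uₑ A′) + s * t ≈⟨ +-congʳ (*-congˡ (*-assoc _ _ _)) ⟩
          - s * t + s * t                      ≈⟨ +-congʳ (-‿distribˡ-* _ _) ⟨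
          - (s * t) + s * t                    ≈⟨ -‿inverseˡ _ ⟩
          0#                                   ∎

      G-pair-cancel : ∀ {B A} → i ∉ B → i ∈ A → G p (toggle i B) (toggle i A) + G p B A ≈ 0#
      G-pair-cancel {B} {A} i∉B i∈A = begin
        G p (toggle i B) (toggle i A) + G p B A
          ≡⟨ ≡.cong (λ C → when (does (boundary C ≟ₘ just p)) (w (toggle i B) (toggle i A)) + G p B A)
                    (toggle-∪ i∈A i∉B) ⟩
        when (does (boundary (A ∪ B) ≟ₘ just p)) (w (toggle i B) (toggle i A)) + G p B A
          ≈⟨ when-dec-cancel (boundary (A ∪ B) ≟ₘ just p) (λ isB →
               let p∉A , p∉B = ∉p∪q⁻ A B (proj₁ (boundary-sound isB)) in w-pair-cancel i∉B i∈A p∉B p∉A) ⟩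
        0# ∎

      private
        Ss = allSubsets n

        ∑∑ : (Subset n → Subset n → Carrier) → Carrier
        ∑∑ H = ∑[ B ∈ Ss ] ∑[ A ∈ Ss ] H B A

        ∑∑-distrib-+ : ∀ H K → ∑∑ (λ B A → H B A + K B A) ≈ ∑∑ H + ∑∑ K
        ∑∑-distrib-+ H K = trans (∑-cong Ss (λ B → ∑-distrib-+ Ss)) (∑-distrib-+ Ss)

        ∑∑-toggle : ∀ H → ∑∑ H ≈ ∑∑ (λ B A → H (toggle i B) (toggle i A))
        ∑∑-toggle H = trans (∑-toggle i (λ B → ∑ Ss (H B))) (∑-cong Ss (λ B → ∑-toggle i (H (toggle i B))))

        G⁺ G⁻ : Subset n → Subset n → Carrier
        G⁺ B A = when (lookup B i ∧ not (lookup A i)) (G p B A)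
        G⁻ B A = when (not (lookup B i) ∧ lookup A i) (G p B A)

        G-split : ∀ B A → G p B A ≈ when (lookup B i ∧ not (lookup A i)) (G p B A) +
                                    when (not (lookup B i) ∧ lookup A i) (G p B A)
        G-split B A with lookup B i in eB | lookup A i in eA
        ... | true  | true  = trans (G-both-in (lookup⇒[]= i B eB) (lookup⇒[]= i A eA)) (sym (+-identityʳ 0#))
        ... | true  | false = sym (+-identityʳ _)
        ... | false | true  = sym (+-identityˡ _)
        ... | false | false = trans (G-neither (lookup≡false⇒∉ eB) (lookup≡false⇒∉ eA)) (sym (+-identityʳ 0#))

        G-pair : ∀ B A → when (lookup (toggle i B) i ∧ not (lookup (toggle i A) i)) (G p (toggle i B) (toggle i A)) +
                         when (not (lookup B i) ∧ lookup A i) (G p B A) ≈ 0#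
        G-pair B A rewrite lookup-toggle i B | lookup-toggle i A with lookup B i in eB | lookup A i in eA
        ... | false | true  = G-pair-cancel (lookup≡false⇒∉ eB) (lookup⇒[]= i A eA)
        ... | true  | true  = +-identityʳ 0#
        ... | true  | false = +-identityʳ 0#
        ... | false | false = +-identityʳ 0#

      ∑∑G≈0 : ∑∑ (G p) ≈ 0#
      ∑∑G≈0 = begin
        ∑∑ (G p)                                          ≈⟨ ∑-cong Ss (λ B → ∑-cong Ss (G-split B)) ⟩
        ∑∑ (λ B A → G⁺ B A + G⁻ B A)                       ≈⟨ ∑∑-distrib-+ G⁺ G⁻ ⟩
        ∑∑ G⁺ + ∑∑ G⁻                                      ≈⟨ +-congʳ (∑∑-toggle G⁺) ⟩
        ∑∑ (λ B A → G⁺ (toggle i B) (toggle i A)) + ∑∑ G⁻  ≈⟨ ∑∑-distrib-+ _ G⁻ ⟨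
        ∑∑ (λ B A → G⁺ (toggle i B) (toggle i A) + G⁻ B A) ≈⟨ ∑-zero Ss (λ B → ∑-zero Ss (G-pair B)) ⟩
        0#                                                ∎

    module _ (1≤N : 1 ≤ N) (N<n : N < n) where

      w≈∑G : ∀ B A → w B A ≈ ∑[ p ∈ allFin n ] G p B A
      w≈∑G B A = sym (∑-when-just (boundary (A ∪ B)) (w B A) w≈0)
        where
        w≈0 : boundary (A ∪ B) ≡ nothing → w B A ≈ 0#
        w≈0 none = when-dec-≈0 (∣ A ∣ ℕ.+ ∣ B ∣ ℕ.≟ N) λ size≡N →
          let x , x∈A∪B = 0<∣p∣+∣q∣⇒Nonempty[p∪q] A B (≡.subst (0 <_) (≡.sym size≡N) 1≤N)
              ∣A∪B∣<n   = ℕ.≤-<-trans (∣p∪q∣≤∣p∣+∣q∣ A B) (≡.subst (_< n) (≡.sym size≡N) N<n)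
              y , y∉A∪B = ∣p∣<n⇒∃∉ ∣A∪B∣<n
              p , some  = boundary-exists x∈A∪B y∉A∪B
          in contradiction (≡.trans (≡.sym some) none) λ ()

      ∑∑w≈0 : ∑[ B ∈ allSubsets n ] ∑[ A ∈ allSubsets n ] w B A ≈ 0#
      ∑∑w≈0 = begin
        ∑[ B ∈ Ss ] ∑[ A ∈ Ss ] w B A               ≈⟨ ∑-cong Ss (λ B → ∑-cong Ss (w≈∑G B)) ⟩
        ∑[ B ∈ Ss ] ∑[ A ∈ Ss ] ∑[ p ∈ Ps ] G p B A ≈⟨ ∑-cong Ss (λ B → ∑-comm Ss Ps _) ⟩
        ∑[ B ∈ Ss ] ∑[ p ∈ Ps ] ∑[ A ∈ Ss ] G p B A ≈⟨ ∑-comm Ss Ps _ ⟩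
        ∑[ p ∈ Ps ] ∑[ B ∈ Ss ] ∑[ A ∈ Ss ] G p B A ≈⟨ ∑-zero Ps ∑∑G≈0 ⟩
        0#                                        ∎
        where
        Ss = allSubsets n
        Ps = allFin n

  P Q : ℕ → Carrier
  P k = hU R n u σ k
  Q k = sumSubsets R n k uₑ

  newton-identity : ∀ {N} → 1 ≤ N → N < n → ∑[ j ∈ upTo (ℕ.suc N) ] (sgn R j * (P j * Q (N ∸ j))) ≈ 0#
  newton-identity {N} 1≤N N<n = trans (sumSubsets-convolution N (sgn R) uₕ uₑ) (∑∑w≈0 N 1≤N N<n)

  private
    ∣⊥∣<n : ∣ ⊥ {n} ∣ < n
    ∣⊥∣<n = ≡.subst (_< n) (≡.sym (∣⊥∣≡0 n)) (ℕ.<-≤-trans (s≤s z≤n) 2≤n)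

  P₀≈1 : P 0 ≈ 1#
  P₀≈1 = trans (∑-when-∣∣≡0 n uₕ) (reflexive (≡.cong (prodU R u) (enumerates-⊥ (proj₁ (hσ ⊥ ∣⊥∣<n)))))

  Q₀≈1 : Q 0 ≈ 1#
  Q₀≈1 = trans (∑-when-∣∣≡0 n uₑ) (reflexive (≡.cong (prodU R u) (enumerates-⊥ (proj₁ (hτ ⊥ ∣⊥∣<n)))))

  Q-recursion : ∀ m → ℕ.suc m < n →
                Q (ℕ.suc m) ≈ ∑[ i ∈ upTo (ℕ.suc m) ] (sgn R i * (P (ℕ.suc i) * Q (m ∸ i)))
  Q-recursion m m+1<n = x∙y⁻¹≈ε⇒x≈y _ _ (begin
    Q (ℕ.suc m) - ∑[ i ∈ is ] T i                                   ≈⟨ +-cong Q-term (-‿∑ is) ⟩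
    sgn R 0 * (P 0 * Q (ℕ.suc m)) + ∑[ i ∈ is ] (- T i)              ≈⟨ +-congˡ (∑-cong is (λ i → -‿distribˡ-* _ _)) ⟩
    sgn R 0 * (P 0 * Q (ℕ.suc m)) + ∑[ i ∈ is ] (sgn R (ℕ.suc i) * (P (ℕ.suc i) * Q (ℕ.suc m ∸ ℕ.suc i)))
      ≡⟨ ∑-upTo-suc (ℕ.suc m) (λ j → sgn R j * (P j * Q (ℕ.suc m ∸ j))) ⟨
    ∑[ j ∈ upTo (ℕ.suc (ℕ.suc m)) ] (sgn R j * (P j * Q (ℕ.suc m ∸ j))) ≈⟨ newton-identity (s≤s z≤n) m+1<n ⟩
    0#                                                              ∎)
    where
    is = upTo (ℕ.suc m)
    T : ℕ → Carrier
    T i = sgn R i * (P (ℕ.suc i) * Q (m ∸ i))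
    Q-term : Q (ℕ.suc m) ≈ sgn R 0 * (P 0 * Q (ℕ.suc m))
    Q-term = sym (trans (*-identityˡ _) (trans (*-congʳ P₀≈1) (*-identityˡ _)))

  private
    sumR-zipWith-cong : ∀ (F : ℕ → Carrier → Carrier) → (∀ i {x y} → x ≈ y → F i x ≈ F i y) →
                        ∀ is {xs ys} → Pointwise _≈_ xs ys → sumR R (zipWith F is xs) ≈ sumR R (zipWith F is ys)
    sumR-zipWith-cong F F-cong []       _             = ≈-refl
    sumR-zipWith-cong F F-cong (i ∷ is) []            = ≈-refl
    sumR-zipWith-cong F F-cong (i ∷ is) (x≈y ∷ xs≈ys) =
      +-cong (F-cong i x≈y) (sumR-zipWith-cong F F-cong is xs≈ys)

  eList≋Q : ∀ m → m < n → Pointwise _≈_ (eList R n u σ m) (applyUpTo (λ i → Q (m ∸ i)) (ℕ.suc m))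
  eList≋Q ℕ.zero    _     = sym Q₀≈1 ∷ []
  eList≋Q (ℕ.suc m) m+1<n = head≈ ∷ eList≋Q′
    where
    F : ℕ → Carrier → Carrier
    F i e = sgn R i * (P (ℕ.suc i) * e)
    eList≋Q′ = eList≋Q m (ℕ.<-trans (ℕ.n<1+n m) m+1<n)
    head≈ = begin
      sumR R (zipWith F (upTo (ℕ.suc m)) (eList R n u σ m))
        ≈⟨ sumR-zipWith-cong F (λ i → *-congˡ ∘ *-congˡ) (upTo (ℕ.suc m)) eList≋Q′ ⟩
      sumR R (zipWith F (upTo (ℕ.suc m)) (applyUpTo (λ i → Q (m ∸ i)) (ℕ.suc m)))
        ≡⟨ ≡.cong (sumR R) (zipWith-applyUpTo F (λ i → i) (λ i → Q (m ∸ i)) (ℕ.suc m)) ⟩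
      sumR R (applyUpTo (λ i → F i (Q (m ∸ i))) (ℕ.suc m))
        ≡⟨ ≡.cong (sumR R) (map-upTo _ (ℕ.suc m)) ⟨
      ∑[ i ∈ upTo (ℕ.suc m) ] F i (Q (m ∸ i))
        ≈⟨ Q-recursion m m+1<n ⟨
      Q (ℕ.suc m)
        ∎

  eU≈sumSubsets : ∀ k → k < n → eU R n u σ k ≈ sumSubsets R n k uₑ
  eU≈sumSubsets ℕ.zero    _   = sym Q₀≈1
  eU≈sumSubsets (ℕ.suc k) k<n = head (eList≋Q (ℕ.suc k) k<n)

proposition9p2 : ∀ {c ℓ : Level} (R : Ring c ℓ) (n : ℕ) → 3 ≤ n →
    (u : Fin n → Ring.Carrier R) → Relations R n u →
    (σ : Subset n → List (Fin n)) → ((A : Subset n) → ∣ A ∣ < n → HOrder A (σ A)) →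
    (τ : Subset n → List (Fin n)) → ((A : Subset n) → ∣ A ∣ < n → EOrder A (τ A)) →
    (k : ℕ) → 1 ≤ k → k ≤ n ∸ 1 →
    Ring._≈_ R (eU R n u σ k) (sumSubsets R n k (λ A → prodU R u (τ A)))
proposition9p2 R (ℕ.suc n) 3≤n@(s≤s _) u rel σ hσ τ hτ k _ k≤n =
  eU≈sumSubsets R (ℕ.≤-trans (ℕ.n≤1+n 2) 3≤n) u rel σ hσ τ hτ k (s≤s k≤n)
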